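{- Let $\mathcal Q$ be a commutative, unital, divisible quantale, $X$ a set, and $s\colon X\times X\to\mathcal Q$ a quasi-reflexive $\mathcal Q$-relation (i.e. $s(x,y)\sqsubseteq s(x,x)$ for all $x,y\in X$). Then $s$ is a quasi$^2$-metric (i.e. $s$ is moreover transitive) if and only if there exists a quasi-metric $q$ on $X$ with $q\sqsupseteq s$ such that either $s\otimes q\sqsubseteq s$ or $q\otimes s\sqsubseteq s$.
   Context: A quantale $\mathcal Q$ is a complete lattice $(\mathcal Q,\sqsubseteq)$ with an associative monoid operation $\otimes$ with unit $1$ preserving arbitrary joins in each argument; commutative means $\otimes$ commutative, unital means $1=\top$, divisible means $x\sqsubseteq y$ iff $x=y\otimes z$ for some $z$. A $\mathcal Q$-relation on $X$ is a map $X\times X\to\mathcal Q$, ordered pointwise, with composition $(s\otimes t)(x,z)=\bigvee_y s(x,y)\otimes t(y,z)$. A relation $s$ is transitive if $s\otimes s\sqsubseteq s$, reflexive if $s(x,x)=1$ for all $x$; a quasi-metric is a reflexive transitive $\mathcal Q$-relation; a quasi$^2$-metric is a transitive $\mathcal Q$-relation that is quasi-reflexive ($s(x,y)\sqsubseteq s(x,x)$). -}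

module Defs where

open import Level using (Level; _⊔_; suc)
open import Data.Product using (Σ; ∃; _×_; _,_)
open import Relation.Binary.PropositionalEquality using (_≡_)

record Quantale (c ℓ i : Level) : Set (suc (c ⊔ ℓ ⊔ i)) where
  infix  4 _⊑_
  infixl 7 _⊗_
  field
    Carrier : Set c
    _⊑_     : Carrier → Carrier → Set ℓ
    ⊑-refl    : ∀ {x} → x ⊑ x
    ⊑-trans   : ∀ {x y z} → x ⊑ y → y ⊑ z → x ⊑ z
    ⊑-antisym : ∀ {x y} → x ⊑ y → y ⊑ x → x ≡ y
    ⋁        : {I : Set i} → (I → Carrier) → Carrier
    ⋁-upper  : {I : Set i} (f : I → Carrier) (j : I) → f j ⊑ ⋁ f
    ⋁-least  : {I : Set i} (f : I → Carrier) (u : Carrier) →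
               (∀ j → f j ⊑ u) → ⋁ f ⊑ u
    _⊗_     : Carrier → Carrier → Carrier
    𝟙       : Carrier
    ⊗-assoc : ∀ x y z → (x ⊗ y) ⊗ z ≡ x ⊗ (y ⊗ z)
    ⊗-identityˡ : ∀ x → 𝟙 ⊗ x ≡ x
    ⊗-identityʳ : ∀ x → x ⊗ 𝟙 ≡ x
    ⊗-distribˡ-⋁ : ∀ {I : Set i} (a : Carrier) (f : I → Carrier) →
                   a ⊗ ⋁ f ≡ ⋁ (λ j → a ⊗ f j)
    ⊗-distribʳ-⋁ : ∀ {I : Set i} (a : Carrier) (f : I → Carrier) →
                   ⋁ f ⊗ a ≡ ⋁ (λ j → f j ⊗ a)

module _ {c ℓ i : Level} (Q : Quantale c ℓ i) where
  open Quantale Q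

  IsCommutative : Set c
  IsCommutative = ∀ x y → x ⊗ y ≡ y ⊗ x

  -- unital (integral): 1 = ⊤, i.e. the unit is the top element
  IsUnital : Set (c ⊔ ℓ)
  IsUnital = ∀ x → x ⊑ 𝟙

  IsDivisible : Set (c ⊔ ℓ)
  IsDivisible = ∀ x y → (x ⊑ y → ∃ λ z → x ≡ y ⊗ z) × ((∃ λ z → x ≡ y ⊗ z) → x ⊑ y)

  QRel : Set i → Set (c ⊔ i)
  QRel X = X → X → Carrier

  _⊑ᵣ_ : {X : Set i} → QRel X → QRel X → Set (ℓ ⊔ i)
  s ⊑ᵣ t = ∀ x y → s x y ⊑ t x y

  _⊗ᵣ_ : {X : Set i} → QRel X → QRel X → QRel X
  (s ⊗ᵣ t) x z = ⋁ (λ y → s x y ⊗ t y z)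

  Transitive : {X : Set i} → QRel X → Set (ℓ ⊔ i)
  Transitive s = (s ⊗ᵣ s) ⊑ᵣ s

  Reflexive : {X : Set i} → QRel X → Set (c ⊔ i)
  Reflexive {X} s = ∀ (x : X) → s x x ≡ 𝟙

  QuasiReflexive : {X : Set i} → QRel X → Set (ℓ ⊔ i)
  QuasiReflexive s = ∀ x y → s x y ⊑ s x x

  QuasiMetric : {X : Set i} → QRel X → Set (c ⊔ ℓ ⊔ i)
  QuasiMetric s = Reflexive s × Transitive s

  Quasi²Metric : {X : Set i} → QRel X → Set (ℓ ⊔ i)
  Quasi²Metric s = Transitive s × QuasiReflexive s

-- If s is transitive, its reflexive closure q is a quasi-metric above s with
-- s ⊗ q ⊑ s, since composing with the diagonal part of q does nothing and
-- composing with the s part is transitivity.  Conversely s ⊑ q gives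
-- s ⊗ s ⊑ s ⊗ q ⊑ s (and symmetrically q ⊗ s).
module Submission where

open import Defs
open import Level using (Level; Lift; lift)
open import Data.Bool using (Bool; true; false)
open import Data.Product using (∃; _×_; _,_)
open import Data.Sum using (_⊎_; inj₁; inj₂)
open import Data.Unit.Polymorphic using (⊤)
open import Function.Bundles using (_⇔_; mk⇔)
open import Relation.Binary.Bundles using (Poset)
open import Relation.Binary.PropositionalEquality
  using (_≡_; refl; cong; isEquivalence)
import Relation.Binary.Reasoning.PartialOrder as PosetReasoning

module QuantaleProperties {c ℓ i : Level} (Q : Quantale c ℓ i) where
  open Quantale Q

  poset : Poset c c ℓ
  poset = record
    { _≈_ = _≡_
    ; _≤_ = _⊑_
    ; isPartialOrder = record
      { isPreorder = record
        { isEquivalence = isEquivalence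
        ; reflexive = λ { refl → ⊑-refl }
        ; trans = ⊑-trans
        }
      ; antisym = ⊑-antisym
      }
    }

  open PosetReasoning poset

  ≡⇒⊑ : ∀ {a b} → a ≡ b → a ⊑ b
  ≡⇒⊑ refl = ⊑-refl

  pairFamily : Carrier → Carrier → Lift i Bool → Carrier
  pairFamily a b (lift false) = a
  pairFamily a b (lift true)  = b

  infixr 6 _∨_

  _∨_ : Carrier → Carrier → Carrier
  a ∨ b = ⋁ (pairFamily a b)

  ⊑⇒∨≡ : ∀ {a b} → a ⊑ b → a ∨ b ≡ b
  ⊑⇒∨≡ {a} {b} a⊑b = ⊑-antisym
    (⋁-least (pairFamily a b) b λ { (lift false) → a⊑b ; (lift true) → ⊑-refl })
    (⋁-upper _ (lift true))

  ⊗-monoˡ-⊑ : ∀ {a b} c → a ⊑ b → a ⊗ c ⊑ b ⊗ c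
  ⊗-monoˡ-⊑ {a} {b} c a⊑b = begin
    a ⊗ c                                    ≤⟨ ⋁-upper (λ j → _ ⊗ c) (lift false) ⟩
    ⋁ (λ j → pairFamily a b j ⊗ c)           ≡⟨ ⊗-distribʳ-⋁ c _ ⟨
    (a ∨ b) ⊗ c                              ≡⟨ cong (_⊗ c) (⊑⇒∨≡ a⊑b) ⟩
    b ⊗ c                                    ∎

  ⊗-monoʳ-⊑ : ∀ {a b} c → a ⊑ b → c ⊗ a ⊑ c ⊗ b
  ⊗-monoʳ-⊑ {a} {b} c a⊑b = begin
    c ⊗ a                                    ≤⟨ ⋁-upper (λ j → c ⊗ _) (lift false) ⟩
    ⋁ (λ j → c ⊗ pairFamily a b j)           ≡⟨ ⊗-distribˡ-⋁ c _ ⟨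
    c ⊗ (a ∨ b)                              ≡⟨ cong (c ⊗_) (⊑⇒∨≡ a⊑b) ⟩
    c ⊗ b                                    ∎

module RelationProperties {c ℓ i : Level} (Q : Quantale c ℓ i) {X : Set i} where
  open Quantale Q
  open QuantaleProperties Q
  open PosetReasoning poset

  private
    Rel : Set (c Level.⊔ i)
    Rel = QRel Q X

    _⊑ᵣ′_ : Rel → Rel → Set (ℓ Level.⊔ i)
    _⊑ᵣ′_ = _⊑ᵣ_ Q

    _⊗ᵣ′_ : Rel → Rel → Rel
    _⊗ᵣ′_ = _⊗ᵣ_ Q

  ⊗ᵣ-upper : (s t : Rel) → ∀ x y z → s x y ⊗ t y z ⊑ (s ⊗ᵣ′ t) x z
  ⊗ᵣ-upper s t x y z = ⋁-upper (λ w → s x w ⊗ t w z) y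

  ⊗ᵣ-least : {s t u : Rel} → (∀ x y z → s x y ⊗ t y z ⊑ u x z) → (s ⊗ᵣ′ t) ⊑ᵣ′ u
  ⊗ᵣ-least {s} {t} {u} h x z = ⋁-least _ (u x z) λ y → h x y z

  ⊗ᵣ-monoˡ : {s s′ : Rel} (t : Rel) → s ⊑ᵣ′ s′ → (s ⊗ᵣ′ t) ⊑ᵣ′ (s′ ⊗ᵣ′ t)
  ⊗ᵣ-monoˡ {s} {s′} t s⊑s′ = ⊗ᵣ-least λ x y z →
    ⊑-trans (⊗-monoˡ-⊑ (t y z) (s⊑s′ x y)) (⊗ᵣ-upper s′ t x y z)

  ⊗ᵣ-monoʳ : {t t′ : Rel} (s : Rel) → t ⊑ᵣ′ t′ → (s ⊗ᵣ′ t) ⊑ᵣ′ (s ⊗ᵣ′ t′)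
  ⊗ᵣ-monoʳ {t} {t′} s t⊑t′ = ⊗ᵣ-least λ x y z →
    ⊑-trans (⊗-monoʳ-⊑ (s x y) (t⊑t′ y z)) (⊗ᵣ-upper s t′ x y z)

  ⊑ᵣ-trans : {s t u : Rel} → s ⊑ᵣ′ t → t ⊑ᵣ′ u → s ⊑ᵣ′ u
  ⊑ᵣ-trans s⊑t t⊑u x y = ⊑-trans (s⊑t x y) (t⊑u x y)

  transitive-⊗ᵣ-absorbsʳ : {s q : Rel} → s ⊑ᵣ′ q → (s ⊗ᵣ′ q) ⊑ᵣ′ s → Transitive Q s
  transitive-⊗ᵣ-absorbsʳ {s} s⊑q sq⊑s = ⊑ᵣ-trans (⊗ᵣ-monoʳ s s⊑q) sq⊑s

  transitive-⊗ᵣ-absorbsˡ : {s q : Rel} → s ⊑ᵣ′ q → (q ⊗ᵣ′ s) ⊑ᵣ′ s → Transitive Q s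
  transitive-⊗ᵣ-absorbsˡ {s} s⊑q qs⊑s = ⊑ᵣ-trans (⊗ᵣ-monoˡ s s⊑q) qs⊑s

  -- The join s ∨ Δ, taken over the index type (x ≡ y) ⊎ ⊤ so that the
  -- diagonal summand 𝟙 is present exactly when x ≡ y.
  closureFamily : Rel → ∀ x y → (x ≡ y) ⊎ ⊤ {i} → Carrier
  closureFamily s x y (inj₁ _) = 𝟙
  closureFamily s x y (inj₂ _) = s x y

  reflexiveClosure : Rel → Rel
  reflexiveClosure s x y = ⋁ (closureFamily s x y)

  module _ (s : Rel) where
    private
      q : Rel
      q = reflexiveClosure s

    ⊑ᵣ-reflexiveClosure : s ⊑ᵣ′ q
    ⊑ᵣ-reflexiveClosure x y = ⋁-upper _ (inj₂ _)

    reflexiveClosure-reflexive : IsUnital Q → Reflexive Q q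
    reflexiveClosure-reflexive unital x = ⊑-antisym (unital _) (⋁-upper _ (inj₁ refl))

    module _ (trans : Transitive Q s) where
      reflexiveClosure-absorbsʳ : ∀ x y z → s x y ⊗ q y z ⊑ s x z
      reflexiveClosure-absorbsʳ x y z = begin
        s x y ⊗ q y z                            ≡⟨ ⊗-distribˡ-⋁ (s x y) _ ⟩
        ⋁ (λ j → s x y ⊗ closureFamily s y z j)  ≤⟨ ⋁-least _ _ summand ⟩
        s x z                                    ∎
        where
        summand : ∀ j → s x y ⊗ closureFamily s y z j ⊑ s x z
        summand (inj₁ refl) = ≡⇒⊑ (⊗-identityʳ _)
        summand (inj₂ _)    = ⊑-trans (⊗ᵣ-upper s s x y z) (trans x z)

      reflexiveClosure-transitive : Transitive Q q
      reflexiveClosure-transitive = ⊗ᵣ-least λ x y z → begin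
        q x y ⊗ q y z                            ≡⟨ ⊗-distribʳ-⋁ (q y z) _ ⟩
        ⋁ (λ j → closureFamily s x y j ⊗ q y z)  ≤⟨ ⋁-least _ _ (summand x y z) ⟩
        q x z                                    ∎
        where
        summand : ∀ x y z j → closureFamily s x y j ⊗ q y z ⊑ q x z
        summand x y z (inj₁ refl) = ≡⇒⊑ (⊗-identityˡ _)
        summand x y z (inj₂ _)    =
          ⊑-trans (reflexiveClosure-absorbsʳ x y z) (⊑ᵣ-reflexiveClosure x z)

proposition3p3 : ∀ {c ℓ i : Level} (Q : Quantale c ℓ i) →
    IsCommutative Q → IsUnital Q → IsDivisible Q →
    {X : Set i} (s : QRel Q X) → QuasiReflexive Q s →
    (Quasi²Metric Q s ⇔
      (∃ λ (q : QRel Q X) → QuasiMetric Q q × _⊑ᵣ_ Q s q ×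
        (_⊑ᵣ_ Q (_⊗ᵣ_ Q s q) s ⊎ _⊑ᵣ_ Q (_⊗ᵣ_ Q q s) s)))
proposition3p3 Q _ unital _ s quasiReflexive = mk⇔ to from
  where
  open RelationProperties Q

  to : Quasi²Metric Q s → _
  to (trans , _) =
    reflexiveClosure s ,
    (reflexiveClosure-reflexive s unital , reflexiveClosure-transitive s trans) ,
    ⊑ᵣ-reflexiveClosure s ,
    inj₁ (⊗ᵣ-least (reflexiveClosure-absorbsʳ s trans))

  from : _ → Quasi²Metric Q s
  from (q , _ , s⊑q , inj₁ sq⊑s) = transitive-⊗ᵣ-absorbsʳ s⊑q sq⊑s , quasiReflexive
  from (q , _ , s⊑q , inj₂ qs⊑s) = transitive-⊗ᵣ-absorbsˡ s⊑q qs⊑s , quasiReflexive
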